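{- There exists a $(\mathbb{Z}_{63}\times \mathbb{F}_{11},\mathbb{Z}_{63}\times \{0\},7,1)$-DF.
   Context: For an additive group $G$ with a subgroup $N$, a $(G,N,k,\lambda)$ relative difference family (DF) is a multiset $[B_1,\dots,B_r]$ of $k$-subsets of $G$ such that the multiset $\bigcup_{i}[x-y: x,y\in B_i, x\neq y]$ contains every element of $G\setminus N$ exactly $\lambda$ times and no element of $N$. Here $\mathbb{Z}_{63}\times\mathbb{F}_{11}$ is the direct product of additive groups. -}

module Defs where

open import Data.Nat using (ℕ; _+_; _∸_; NonZero)
open import Data.Nat.DivMod using (_mod_)
open import Data.Fin using (Fin; toℕ)
open import Data.Fin.Properties using () renaming (_≟_ to _≟ᶠ_)
open import Data.Product using (_×_; _,_; proj₁; proj₂; Σ)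
open import Data.Product.Properties using (≡-dec)
open import Data.List using (List; []; _∷_; concatMap; allFin; filter; length)
open import Data.List.Relation.Unary.All using (All)
open import Data.Vec using (Vec; lookup)
open import Relation.Nullary using (¬_; yes; no)
open import Relation.Binary.PropositionalEquality using (_≡_)
open import Relation.Binary using (DecidableEquality)

_-ₙ_ : ∀ {n} .{{_ : NonZero n}} → Fin n → Fin n → Fin n
_-ₙ_ {n} x y = (toℕ x + (n ∸ toℕ y)) mod n

-- The group G = Z_a × Z_p (direct product of additive groups);
-- for p = 11 prime, (F_11, +) is Z_11.
G : ℕ → ℕ → Set
G a p = Fin a × Fin p

_≟G_ : ∀ {a p} → DecidableEquality (G a p)
_≟G_ = ≡-dec _≟ᶠ_ _≟ᶠ_

_-G_ : ∀ {a p} .{{_ : NonZero a}} .{{_ : NonZero p}} → G a p → G a p → G a p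
(x₁ , x₂) -G (y₁ , y₂) = (x₁ -ₙ y₁) , (x₂ -ₙ y₂)

InN : ∀ {a p} → G a p → Set
InN g = toℕ (proj₂ g) ≡ 0

IsKSubset : ∀ {a p k} → Vec (G a p) k → Set
IsKSubset {k = k} B = ∀ (i j : Fin k) → lookup B i ≡ lookup B j → i ≡ j

diffs : ∀ {a p k} .{{_ : NonZero a}} .{{_ : NonZero p}} → Vec (G a p) k → List (G a p)
diffs {k = k} B = concatMap (λ i → concatMap (λ j → pick i j) (allFin k)) (allFin k)
  where
  pick : Fin k → Fin k → List _
  pick i j with i ≟ᶠ j
  ... | yes _ = []
  ... | no _ = (lookup B i -G lookup B j) ∷ []

allDiffs : ∀ {a p k} .{{_ : NonZero a}} .{{_ : NonZero p}} → List (Vec (G a p) k) → List (G a p)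
allDiffs = concatMap diffs

mult : ∀ {a p} → G a p → List (G a p) → ℕ
mult g xs = length (filter (λ x → x ≟G g) xs)

IsRelDF : (a p k λ' : ℕ) .{{_ : NonZero a}} .{{_ : NonZero p}} → List (Vec (G a p) k) → Set
IsRelDF a p k λ' Bs =
  All IsKSubset Bs ×
  (∀ (g : G a p) → (InN g → mult g (allDiffs Bs) ≡ 0) × (¬ InN g → mult g (allDiffs Bs) ≡ λ'))

RelDF : (a p k λ' : ℕ) .{{_ : NonZero a}} .{{_ : NonZero p}} → Set
RelDF a p k λ' = Σ (List (Vec (G a p) k)) (IsRelDF a p k λ')

-- The blocks are the images of three base blocks under multiplication of the
-- F₁₁-coordinate by the five nonzero squares of F₁₁. For every x ∈ Z₆₃ exactly two
-- of the 3 · 42 base differences have first coordinate x, and their second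
-- coordinates are a nonzero square and a nonsquare. As the squares permute each
-- of the two cosets of the squares in F₁₁ˣ, the developed differences hit every
-- (x , y) with y ≠ 0 exactly once and never hit Z₆₃ × {0}.
module Submission where

open import Defs
open import Data.Nat using (NonZero; _*_; _≟_)
open import Data.Nat.DivMod using (_mod_)
open import Data.Fin using (Fin; #_; toℕ) renaming (_≟_ to _≟ᶠ_)
open import Data.Fin.Properties using (all?)
open import Data.List using (List; []; _∷_; concatMap; map)
import Data.List.Relation.Unary.All as All
open import Data.Vec as Vec using (Vec; []; _∷_; lookup)
open import Data.Product using (_,_; proj₂)
open import Relation.Nullary using (Dec; ¬?)
open import Relation.Nullary.Decidable using (toWitness; map′; _×-dec_; _→-dec_)

isKSubset? : ∀ {a p k} (B : Vec (G a p) k) → Dec (IsKSubset B)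
isKSubset? B = all? λ i → all? λ j → (lookup B i ≟G lookup B j) →-dec (i ≟ᶠ j)

allG? : ∀ {a p ℓ} {P : G a p → Set ℓ} → (∀ g → Dec (P g)) → Dec (∀ g → P g)
allG? P? = map′ (λ ∀P (x , y) → ∀P x y) (λ ∀P x y → ∀P (x , y)) (all? λ x → all? λ y → P? (x , y))

inN? : ∀ {a p} (g : G a p) → Dec (InN g)
inN? g = toℕ (proj₂ g) ≟ 0

isRelDF? : ∀ a p k λ' .{{_ : NonZero a}} .{{_ : NonZero p}} (Bs : List (Vec (G a p) k)) →
           Dec (IsRelDF a p k λ' Bs)
isRelDF? a p k λ' Bs =
  All.all? isKSubset? Bs ×-dec
  allG? λ g → (inN? g →-dec (mult g (allDiffs Bs) ≟ 0)) ×-dec (¬? (inN? g) →-dec (mult g (allDiffs Bs) ≟ λ'))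

scale : ∀ {a p} .{{_ : NonZero p}} → Fin p → G a p → G a p
scale {p = p} s (x , y) = x , (toℕ s * toℕ y) mod p

baseBlocks : List (Vec (G 63 11) 7)
baseBlocks =
  ((# 0 , # 0) ∷ (# 1 , # 1) ∷ (# 55 , # 2) ∷ (# 24 , # 3) ∷ (# 60 , # 10) ∷ (# 49 , # 5) ∷ (# 49 , # 8) ∷ []) ∷
  ((# 0 , # 0) ∷ (# 2 , # 1) ∷ (# 47 , # 6) ∷ (# 4 , # 3) ∷ (# 31 , # 9) ∷ (# 21 , # 7) ∷ (# 28 , # 2) ∷ []) ∷
  ((# 0 , # 0) ∷ (# 5 , # 1) ∷ (# 23 , # 4) ∷ (# 13 , # 3) ∷ (# 22 , # 8) ∷ (# 35 , # 7) ∷ (# 56 , # 10) ∷ []) ∷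
  []

nonzeroSquares : List (Fin 11)
nonzeroSquares = # 1 ∷ # 3 ∷ # 9 ∷ # 5 ∷ # 4 ∷ []

developedFamily : List (Vec (G 63 11) 7)
developedFamily = concatMap (λ B → map (λ s → Vec.map (scale s) B) nonzeroSquares) baseBlocks

lemma2p3 : RelDF 63 11 7 1
lemma2p3 = developedFamily , toWitness {a? = isRelDF? 63 11 7 1 developedFamily} _
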